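{- Let $n\geqslant 5$, let $i\neq j$ be elements of $\{1,\dots,n\}$, and let $P$ be the subgraph of $BS_n$ whose vertex set consists of all permutations whose last two entries are $i$ and $j$ (in either order), with edges the edges of $BS_n$ corresponding to $b_1,\dots,b_{n-3},b_{n-1}$ among these vertices (so $P\cong BS_{n-2}\times K_2$). Then for every vertex $\pi$ of $P$ and every vertex $\tau$ of $P$ such that $\pi$ and $\tau$ have different parity as permutations, there is a Hamiltonian path of $P$ with end vertices $\pi$ and $\tau$.
   Context: $Sym_n$ is the symmetric group of permutations of $\{1,\dots,n\}$; $b_i=(i\ i+1)$ for $1\leqslant i\leqslant n-1$, acting by right multiplication (swapping positions $i$ and $i+1$). The Bubble-sort graph $BS_n=Cay(Sym_n,\{b_1,\dots,b_{n-1}\})$ has $\pi$ adjacent to $\pi b_i$. The parity of a permutation is its sign (even or odd). -}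

module Defs where

open import Data.Nat using (ℕ; zero; suc; _+_; _∸_; _≤_; _%_)
open import Data.Fin using (Fin; _<?_)
open import Data.Vec using (Vec; []; _∷_; lookup; toList)
open import Data.List using (List; []; _∷_; _++_; length; filter; head; last)
open import Data.List.Relation.Unary.All using (All)
open import Data.List.Relation.Unary.Linked using (Linked)
open import Data.List.Relation.Unary.Unique.Propositional using (Unique)
open import Data.List.Membership.Propositional using (_∈_)
open import Data.Maybe using (just)
open import Data.Product using (Σ; ∃; _×_)
open import Data.Sum using (_⊎_)
open import Relation.Binary.PropositionalEquality using (_≡_)

-- Permutations of {1..n} (encoded as Fin n = {0..n-1}) in one-line notation:
-- σ = (σ(1), ..., σ(n)) as a vector of length n with pairwise distinct entries.
IsPerm : ∀ {n} → Vec (Fin n) n → Set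
IsPerm {n} σ = ∀ (a b : Fin n) → lookup σ a ≡ lookup σ b → a ≡ b

swapAt : ∀ {A : Set} {n} → ℕ → Vec A n → Vec A n
swapAt zero    (x ∷ y ∷ xs) = y ∷ x ∷ xs
swapAt zero    xs           = xs
swapAt (suc t) []           = []
swapAt (suc t) (x ∷ xs)     = x ∷ swapAt t xs

-- Right multiplication by the transposition b_k = (k k+1), 1 ≤ k ≤ n-1:
-- swaps positions k and k+1 (1-based).  (b 0 is unused.)
b : ∀ {A : Set} {n} → ℕ → Vec A n → Vec A n
b zero    σ = σ
b (suc t) σ = swapAt t σ

inversions : ∀ {n} → List (Fin n) → ℕ
inversions []       = 0
inversions (x ∷ xs) = length (filter (_<? x) xs) + inversions xs

parity : ∀ {n} → Vec (Fin n) n → ℕ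
parity σ = inversions (toList σ) % 2

EndsWith : ∀ {n} → Fin n → Fin n → Vec (Fin n) n → Set
EndsWith x y σ = ∃ λ ys → toList σ ≡ ys ++ (x ∷ y ∷ [])

PVertex : ∀ {n} → Fin n → Fin n → Vec (Fin n) n → Set
PVertex i j σ = IsPerm σ × (EndsWith i j σ ⊎ EndsWith j i σ)

PGen : ℕ → ℕ → Set
PGen n k = (1 ≤ k × k ≤ n ∸ 3) ⊎ k ≡ n ∸ 1

PAdj : ∀ {n} → Vec (Fin n) n → Vec (Fin n) n → Set
PAdj {n} σ ρ = ∃ λ k → PGen n k × ρ ≡ b k σ

record HamPathP {n} (i j : Fin n) (π τ : Vec (Fin n) n)
                (ps : List (Vec (Fin n) n)) : Set where
  field
    inP     : All (PVertex i j) ps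
    edges   : Linked PAdj ps
    noRep   : Unique ps
    covers  : ∀ σ → PVertex i j σ → σ ∈ ps
    start   : head ps ≡ just π
    finish  : last ps ≡ just τ

-- P is BS_{n-2} × K_2: b_1, …, b_{n-3} permute the first n-2 entries and b_{n-1} swaps the last two,
-- and every edge changes the sign. We prove more generally, by induction on m, that BS_m × K_2 is
-- Hamiltonian laceable. Its vertices split into m blocks according to the m-th entry, each a copy of
-- BS_{m-1} × K_2, and b_{m-1} joins different blocks. If the end vertices lie in different blocks,
-- a Hamiltonian path visits all blocks in an order starting and ending with theirs, moving from one
-- block to the next along b_{m-1} at a vertex of the required sign. If both lie in one block a, take
-- a Hamiltonian path of block a and an edge p q of it whose (m-1)-st entries differ (any edge when
-- m = 2); the b_{m-1}-neighbours of p and q lie in blocks other than a, and a Hamiltonian path through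
-- all those blocks between them replaces the edge p q. The argument only needs n ≥ 2.

module Submission where

open import Defs
open import Data.Bool.Base using (Bool; true; false; not)
open import Data.Empty using (⊥-elim)
open import Data.Fin.Base as Fin using (Fin; punchOut)
open import Data.Fin using (_<?_)
import Data.Fin.Properties as Finₚ
open import Data.Fin.Properties using (_≟_; <-cmp; <-asym; punchOut-injective; <⇒notInjective)
open import Data.List.Base
  using (List; []; _∷_; _++_; [_]; _∷ʳ_; length; filter; drop; head; last; allFin; initLast; _∷ʳ′_)
open import Data.List.Properties
  using (length-++; length-tabulate; filter-accept; filter-reject; filter-all; ++-assoc)
open import Data.List.Membership.Propositional using (_∈_; _∉_; find; lose)
open import Data.List.Membership.Propositional.Properties
  using (∈-++⁺ˡ; ∈-++⁺ʳ; ∈-++⁻; ∈-filter⁺; ∈-filter⁻; ∈-allFin)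
open import Data.List.Relation.Binary.Disjoint.Propositional using (Disjoint)
open import Data.List.Relation.Binary.Permutation.Propositional
  using (_↭_; ↭-refl; ↭-prep; ↭-swap; ↭-sym; ↭⇒↭ₛ)
open import Data.List.Relation.Binary.Permutation.Propositional.Properties
  using (↭-length; filter-↭; shifts; ∈-resp-↭)
import Data.List.Relation.Binary.Permutation.Setoid.Properties as PermutationSetoid
open import Data.List.Relation.Binary.Subset.Propositional using (_⊆_)
open import Data.List.Relation.Unary.All as All using (All; []; _∷_)
open import Data.List.Relation.Unary.All.Properties using (++⁺; ++⁻ˡ; ++⁻ʳ; ¬Any⇒All¬; All¬⇒¬Any)
open import Data.List.Relation.Unary.AllPairs as AllPairs using ([]; _∷_)
open import Data.List.Relation.Unary.Any using (Any; here; there; any?)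
open import Data.List.Relation.Unary.Linked as Linked using (Linked; [-]; _∷_)
open import Data.List.Relation.Unary.Unique.Propositional using (Unique)
import Data.List.Relation.Unary.Unique.Propositional.Properties as Unique
open import Data.Maybe.Base using (Maybe; just)
open import Data.Maybe.Properties using (just-injective; ≡-dec)
open import Data.Nat.Base as ℕ using (ℕ; zero; suc; _+_; _≤_; _<_; _%_; s≤s; z≤n)
open import Data.Nat.Properties
  using ( suc-injective; +-suc; +-assoc; +-comm; +-identityʳ; +-cancelʳ-≡; +-commutativeSemigroup
        ; ≤-refl; ≤-trans; <⇒≤; n≤1+n; n<1+n; m<n⇒m<1+n; m≤m+n; ∸-monoˡ-≤)
open import Data.Parity.Base using (Parity; 0ℙ; 1ℙ; _⁻¹)
open import Data.Parity.Properties using (suc-homo-⁻¹; ⁻¹-involutive; p≢p⁻¹)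
open import Data.Product.Base using (Σ; ∃; _×_; _,_; proj₁; proj₂)
open import Data.Sum.Base using (_⊎_; inj₁; inj₂; [_,_]′; map₁)
open import Data.Vec.Base using (Vec; []; _∷_; toList; fromList; cast; lookup)
open import Data.Vec.Properties
  using (length-toList; toList-injective; cast-is-id; toList-cast; toList∘fromList)
open import Function.Base using (_∘_; case_of_)
open import Relation.Binary.Definitions using (DecidableEquality; tri<; tri≈; tri>)
open import Relation.Binary.PropositionalEquality
  using (_≡_; _≢_; ≢-sym; refl; sym; trans; cong; cong₂; subst; setoid; module ≡-Reasoning)
open import Relation.Nullary.Decidable using (Dec; yes; no; ¬?)
open import Relation.Unary using (_∪_; _∩_; _≐_; Empty)
open import Relation.Unary.Properties using (≐-sym; ≐-trans)

open import Algebra.Properties.CommutativeSemigroup +-commutativeSemigroup using (x∙yz≈y∙xz)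

module _ {A : Set} where

  swapAtᴸ : ℕ → List A → List A
  swapAtᴸ zero    (x ∷ y ∷ xs) = y ∷ x ∷ xs
  swapAtᴸ zero    xs           = xs
  swapAtᴸ (suc t) []           = []
  swapAtᴸ (suc t) (x ∷ xs)     = x ∷ swapAtᴸ t xs

  swapAtᴸ-++ : ∀ (xs : List A) x y ys → swapAtᴸ (length xs) (xs ++ x ∷ y ∷ ys) ≡ xs ++ y ∷ x ∷ ys
  swapAtᴸ-++ []       x y ys = refl
  swapAtᴸ-++ (z ∷ xs) x y ys = cong (z ∷_) (swapAtᴸ-++ xs x y ys)

  swapAtᴸ-involutive : ∀ t (xs : List A) → swapAtᴸ t (swapAtᴸ t xs) ≡ xs
  swapAtᴸ-involutive zero    []           = refl
  swapAtᴸ-involutive zero    (x ∷ [])     = refl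
  swapAtᴸ-involutive zero    (x ∷ y ∷ xs) = refl
  swapAtᴸ-involutive (suc t) []           = refl
  swapAtᴸ-involutive (suc t) (x ∷ xs)     = cong (x ∷_) (swapAtᴸ-involutive t xs)

  swapAtᴸ-↭ : ∀ t (xs : List A) → swapAtᴸ t xs ↭ xs
  swapAtᴸ-↭ zero    []           = ↭-refl
  swapAtᴸ-↭ zero    (x ∷ [])     = ↭-refl
  swapAtᴸ-↭ zero    (x ∷ y ∷ xs) = ↭-swap y x ↭-refl
  swapAtᴸ-↭ (suc t) []           = ↭-refl
  swapAtᴸ-↭ (suc t) (x ∷ xs)     = ↭-prep x (swapAtᴸ-↭ t xs)

  entryAt : ℕ → List A → Maybe A
  entryAt k xs = head (drop k xs)

  entryAt-++ : ∀ (xs : List A) x ys → entryAt (length xs) (xs ++ x ∷ ys) ≡ just x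
  entryAt-++ []       x ys = refl
  entryAt-++ (z ∷ xs) x ys = entryAt-++ xs x ys

  Unique-++⁻ : ∀ (xs : List A) {ys} → Unique (xs ++ ys) → Unique xs × Unique ys × Disjoint xs ys
  Unique-++⁻ []       u        = [] , u , λ ()
  Unique-++⁻ (x ∷ xs) (x∉ ∷ u) with Unique-++⁻ xs u
  ... | uxs , uys , disj =
    ++⁻ˡ xs x∉ ∷ uxs , uys ,
    λ { (here refl , m) → All.lookup (++⁻ʳ xs x∉) m refl ; (there m₁ , m₂) → disj (m₁ , m₂) }

  length-∷ʳ : ∀ (xs : List A) {x} → length (xs ∷ʳ x) ≡ suc (length xs)
  length-∷ʳ xs = trans (length-++ xs) (+-comm (length xs) 1)

  length≡1⇒≡ : ∀ {T : List A} {x y} → length T ≡ 1 → x ∈ T → y ∈ T → x ≡ y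
  length≡1⇒≡ {_ ∷ []} _ (here refl) (here refl) = refl

  lastOf : A → List A → A
  lastOf c []       = c
  lastOf c (d ∷ ds) = lastOf d ds

  lastOf-∷ʳ : ∀ c (xs : List A) z → lastOf c (xs ∷ʳ z) ≡ z
  lastOf-∷ʳ c []       z = refl
  lastOf-∷ʳ c (x ∷ xs) z = lastOf-∷ʳ x xs z

module _ {A : Set} where

  toList-swapAt : ∀ {n} t (σ : Vec A n) → toList (swapAt t σ) ≡ swapAtᴸ t (toList σ)
  toList-swapAt zero    []          = refl
  toList-swapAt zero    (x ∷ [])    = refl
  toList-swapAt zero    (x ∷ y ∷ σ) = refl
  toList-swapAt (suc t) []          = refl
  toList-swapAt (suc t) (x ∷ σ)     = cong (x ∷_) (toList-swapAt t σ)

  toList-injective′ : ∀ {n} {u w : Vec A n} → toList u ≡ toList w → u ≡ w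
  toList-injective′ {u = u} {w} eq = trans (sym (cast-is-id refl u)) (toList-injective refl u w eq)

  lookup-∈ : ∀ {n} (σ : Vec A n) a → lookup σ a ∈ toList σ
  lookup-∈ (x ∷ σ) Fin.zero    = here refl
  lookup-∈ (x ∷ σ) (Fin.suc a) = there (lookup-∈ σ a)

  ∈⇒lookup : ∀ {n x} (σ : Vec A n) → x ∈ toList σ → ∃ λ a → lookup σ a ≡ x
  ∈⇒lookup (y ∷ σ) (here refl) = Fin.zero , refl
  ∈⇒lookup (y ∷ σ) (there m)   = let a , eq = ∈⇒lookup σ m in Fin.suc a , eq

  Injective-lookup⇒Unique : ∀ {n} (σ : Vec A n) → (∀ a b → lookup σ a ≡ lookup σ b → a ≡ b) →
                            Unique (toList σ)
  Injective-lookup⇒Unique []      _   = []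
  Injective-lookup⇒Unique (x ∷ σ) inj =
    All.tabulate (λ m x≡y → let a , eq = ∈⇒lookup σ m in
                              case inj Fin.zero (Fin.suc a) (trans x≡y (sym eq)) of λ ())
    ∷ Injective-lookup⇒Unique σ (λ a b eq → Finₚ.suc-injective (inj (Fin.suc a) (Fin.suc b) eq))

  Unique⇒Injective-lookup : ∀ {n} (σ : Vec A n) → Unique (toList σ) →
                            ∀ a b → lookup σ a ≡ lookup σ b → a ≡ b
  Unique⇒Injective-lookup (x ∷ σ) _        Fin.zero    Fin.zero    _  = refl
  Unique⇒Injective-lookup (x ∷ σ) (x∉ ∷ _) Fin.zero    (Fin.suc b) eq = ⊥-elim (All.lookup x∉ (lookup-∈ σ b) eq)
  Unique⇒Injective-lookup (x ∷ σ) (x∉ ∷ _) (Fin.suc a) Fin.zero    eq =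
    ⊥-elim (All.lookup x∉ (lookup-∈ σ a) (sym eq))
  Unique⇒Injective-lookup (x ∷ σ) (_ ∷ u)  (Fin.suc a) (Fin.suc b) eq =
    cong Fin.suc (Unique⇒Injective-lookup σ u a b eq)

-- If x were missing, punching it out of σ would inject Fin (suc n) into Fin n.
IsPerm⇒∈ : ∀ {n} {σ : Vec (Fin n) n} → IsPerm σ → ∀ x → x ∈ toList σ
IsPerm⇒∈ {suc n} {σ} perm x with any? (x ≟_) (toList σ)
... | yes x∈σ = x∈σ
... | no x∉σ  = ⊥-elim (<⇒notInjective (n<1+n n) punchOut-inj)
  where
  x≢ : ∀ a → x ≢ lookup σ a
  x≢ a eq = x∉σ (subst (_∈ toList σ) (sym eq) (lookup-∈ σ a))
  punchOut-inj : ∀ {a b} → punchOut (x≢ a) ≡ punchOut (x≢ b) → a ≡ b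
  punchOut-inj eq = perm _ _ (punchOut-injective (x≢ _) (x≢ _) eq)

OneApart : ℕ → ℕ → Set
OneApart m n = m ≡ suc n ⊎ n ≡ suc m

OneApart-+ : ∀ {a b m n} → a ≡ b → OneApart m n → OneApart (a + m) (b + n)
OneApart-+ {a} refl (inj₁ refl) = inj₁ (+-suc a _)
OneApart-+ {a} refl (inj₂ refl) = inj₂ (+-suc a _)

parity-OneApart : ∀ {m n} → OneApart m n → ℕ.parity m ≡ ℕ.parity n ⁻¹
parity-OneApart {n = n} (inj₁ refl) = trans (sym (⁻¹-involutive _)) (cong _⁻¹ (suc-homo-⁻¹ n))
parity-OneApart {m = m} (inj₂ refl) = sym (suc-homo-⁻¹ m)

module _ {n : ℕ} where

  smaller : Fin n → List (Fin n) → ℕ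
  smaller x xs = length (filter (_<? x) xs)

  smaller-↭ : ∀ x {xs ys} → xs ↭ ys → smaller x xs ≡ smaller x ys
  smaller-↭ x p = ↭-length (filter-↭ (_<? x) p)

  inversions-swap-head : ∀ {x y} r → x Fin.< y → inversions (y ∷ x ∷ r) ≡ suc (inversions (x ∷ y ∷ r))
  inversions-swap-head {x} {y} r x<y = begin
    length (filter (_<? y) (x ∷ r)) + (smaller x r + inversions r)
      ≡⟨ cong (λ l → length l + (smaller x r + inversions r)) (filter-accept (_<? y) x<y) ⟩
    suc (smaller y r + (smaller x r + inversions r))
      ≡⟨ cong suc (x∙yz≈y∙xz (smaller y r) (smaller x r) (inversions r)) ⟩
    suc (smaller x r + (smaller y r + inversions r))
      ≡⟨ cong (λ l → suc (length l + (smaller y r + inversions r)))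
              (sym (filter-reject (_<? x) (<-asym x<y))) ⟩
    suc (length (filter (_<? x) (y ∷ r)) + (smaller y r + inversions r)) ∎
    where open ≡-Reasoning

  inversions-swapAtᴸ : ∀ t (xs : List (Fin n)) → Unique xs → suc t < length xs →
    OneApart (inversions (swapAtᴸ t xs)) (inversions xs)
  inversions-swapAtᴸ zero (x ∷ y ∷ r) (x∉ ∷ _) _ with <-cmp x y
  ... | tri< x<y _ _ = inj₁ (inversions-swap-head r x<y)
  ... | tri≈ _ x≡y _ = ⊥-elim (All.lookup x∉ (here refl) x≡y)
  ... | tri> _ _ y<x = inj₂ (inversions-swap-head r y<x)
  inversions-swapAtᴸ zero (x ∷ []) _ (s≤s ())
  inversions-swapAtᴸ (suc t) (x ∷ xs) (_ ∷ u) (s≤s t<) =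
    OneApart-+ (smaller-↭ x (swapAtᴸ-↭ t xs)) (inversions-swapAtᴸ t xs u t<)

sign : ∀ {n} → List (Fin n) → Parity
sign = ℕ.parity ∘ inversions

sign-swapAtᴸ : ∀ {n} t (xs : List (Fin n)) → Unique xs → suc t < length xs →
               sign (swapAtᴸ t xs) ≡ sign xs ⁻¹
sign-swapAtᴸ t xs u t< = parity-OneApart (inversions-swapAtᴸ t xs u t<)

ℕ-parity⇒%2 : ∀ m n → ℕ.parity m ≡ ℕ.parity n → m % 2 ≡ n % 2
ℕ-parity⇒%2 m n eq = trans (%2-parity m) (trans (cong bit eq) (sym (%2-parity n)))
  where
  bit : Parity → ℕ
  bit 0ℙ = 0
  bit 1ℙ = 1
  %2-parity : ∀ n → n % 2 ≡ bit (ℕ.parity n)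
  %2-parity zero          = refl
  %2-parity (suc zero)    = refl
  %2-parity (suc (suc n)) = %2-parity n

module Removal {A : Set} (_≟ᴬ_ : DecidableEquality A) where

  _≢?_ : ∀ x c → Dec (x ≢ c)
  x ≢? c = ¬? (x ≟ᴬ c)

  remove : A → List A → List A
  remove c = filter (_≢? c)

  ∈-remove⁺ : ∀ {c x xs} → x ∈ xs → x ≢ c → x ∈ remove c xs
  ∈-remove⁺ {c} = ∈-filter⁺ (_≢? c)

  ∈-remove⁻ : ∀ {c x} xs → x ∈ remove c xs → x ∈ xs × x ≢ c
  ∈-remove⁻ {c} xs = ∈-filter⁻ (_≢? c) {xs = xs}

  remove-unique : ∀ {c xs} → Unique xs → Unique (remove c xs)
  remove-unique {c} = Unique.filter⁺ (_≢? c)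

  length-remove : ∀ {c xs} → Unique xs → c ∈ xs → suc (length (remove c xs)) ≡ length xs
  length-remove {c} {c ∷ xs} (c∉ ∷ _) (here refl) =
    cong (suc ∘ length) (trans (filter-reject (_≢? c) (λ c≢c → c≢c refl))
                               (filter-all (_≢? c) (All.map (λ c≢x → c≢x ∘ sym) c∉)))
  length-remove {c} {y ∷ xs} (y∉ ∷ u) (there c∈) =
    cong suc (trans (cong length (filter-accept (_≢? c) y≢c)) (length-remove u c∈))
    where
    y≢c : y ≢ c
    y≢c = All.lookup y∉ c∈

  other-than : ∀ {T n} → Unique T → length T ≡ suc (suc n) → ∀ x → ∃ λ y → y ∈ T × y ≢ x
  other-than {y₁ ∷ y₂ ∷ _} (y₁∉ ∷ _) _ x with y₁ ≟ᴬ x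
  ... | yes refl = y₂ , there (here refl) , ≢-sym (All.head y₁∉)
  ... | no y₁≢x  = y₁ , here refl , y₁≢x

  record Enumeration (T : List A) (first final : A) : Set where
    constructor enumeration
    field
      rest     : List A
      ends     : lastOf first rest ≡ final
      unique   : Unique (first ∷ rest)
      sound    : All (_∈ T) (first ∷ rest)
      complete : T ⊆ first ∷ rest

  Enumeration-∷ : ∀ {T a d d′} → a ∈ T → Enumeration (remove a T) d d′ → Enumeration T a d′
  Enumeration-∷ {T} {a} a∈T (enumeration rest ends unique sound complete) =
    enumeration (_ ∷ rest) ends
      (All.tabulate (λ m a≡x → proj₂ (∈-remove⁻ T (All.lookup sound (subst (_∈ _) (sym a≡x) m))) refl)
        ∷ unique)
      (a∈T ∷ All.map (proj₁ ∘ ∈-remove⁻ T) sound)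
      λ {x} x∈T → case x ≟ᴬ a of λ
        { (yes refl) → here refl
        ; (no x≢a)   → there (complete (∈-remove⁺ x∈T x≢a)) }

  enumerate : ∀ {T d d′} → Unique T → d ∈ T → d′ ∈ T → d ≢ d′ ⊎ length T ≡ 1 → Enumeration T d d′
  enumerate {T} {d} {d′} uT d∈T d′∈T (inj₁ d≢d′) =
    enumeration (middle ∷ʳ d′) (lastOf-∷ʳ d middle d′)
      (++⁺ (All.tabulate (λ m → ≢-sym (proj₂ (in-middle m)))) (d≢d′ ∷ [])
        ∷ Unique.++⁺ (remove-unique (remove-unique uT)) ([] ∷ [])
            (λ { (m , here refl) → proj₂ (∈-remove⁻ (remove d T) m) refl }))
      (d∈T ∷ ++⁺ (All.tabulate (proj₁ ∘ in-middle)) (d′∈T ∷ []))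
      complete
    where
    middle = remove d′ (remove d T)
    in-middle : ∀ {x} → x ∈ middle → x ∈ T × x ≢ d
    in-middle m = ∈-remove⁻ T (proj₁ (∈-remove⁻ (remove d T) m))
    complete : T ⊆ d ∷ middle ∷ʳ d′
    complete {x} x∈T with x ≟ᴬ d | x ≟ᴬ d′
    ... | yes refl | _        = here refl
    ... | no _     | yes refl = there (∈-++⁺ʳ middle (here refl))
    ... | no x≢d   | no x≢d′  = there (∈-++⁺ˡ (∈-remove⁺ (∈-remove⁺ x∈T x≢d) x≢d′))
  enumerate {t ∷ []} _ (here refl) (here refl) (inj₂ _) =
    enumeration [] refl ([] ∷ []) (here refl ∷ []) (λ m → m)

module _ {V : Set} where

  open PermutationSetoid (setoid V) using (Unique-resp-↭)

  data Walk (R : V → V → Set) : V → V → Set where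
    [_]ʷ   : ∀ v → Walk R v v
    _∷⟨_⟩_ : ∀ u {w v} → R u w → Walk R w v → Walk R u v

  module _ {R : V → V → Set} where

    vertices : ∀ {u v} → Walk R u v → List V
    vertices [ v ]ʷ        = v ∷ []
    vertices (u ∷⟨ _ ⟩ w) = u ∷ vertices w

    _⟨_⟩ʷ_ : ∀ {u w x v} → Walk R u w → R w x → Walk R x v → Walk R u v
    [ w ]ʷ        ⟨ e ⟩ʷ q = w ∷⟨ e ⟩ q
    (u ∷⟨ e′ ⟩ p) ⟨ e ⟩ʷ q = u ∷⟨ e′ ⟩ (p ⟨ e ⟩ʷ q)

    vertices-⟨⟩ʷ : ∀ {u w x v} (p : Walk R u w) (e : R w x) (q : Walk R x v) →
                   vertices (p ⟨ e ⟩ʷ q) ≡ vertices p ++ vertices q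
    vertices-⟨⟩ʷ [ w ]ʷ        e q = refl
    vertices-⟨⟩ʷ (u ∷⟨ e′ ⟩ p) e q = cong (u ∷_) (vertices-⟨⟩ʷ p e q)

    head-vertices : ∀ {u v} (p : Walk R u v) → head (vertices p) ≡ just u
    head-vertices [ v ]ʷ        = refl
    head-vertices (u ∷⟨ _ ⟩ p) = refl

    last-vertices : ∀ {u v} (p : Walk R u v) → last (vertices p) ≡ just v
    last-vertices [ v ]ʷ                    = refl
    last-vertices (u ∷⟨ _ ⟩ [ v ]ʷ)         = refl
    last-vertices (u ∷⟨ _ ⟩ p@(_ ∷⟨ _ ⟩ _)) = last-vertices p

    start∈vertices : ∀ {u v} (p : Walk R u v) → u ∈ vertices p
    start∈vertices [ v ]ʷ        = here refl
    start∈vertices (u ∷⟨ _ ⟩ p) = here refl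

    end∈vertices : ∀ {u v} (p : Walk R u v) → v ∈ vertices p
    end∈vertices [ v ]ʷ        = here refl
    end∈vertices (u ∷⟨ _ ⟩ p) = there (end∈vertices p)

    Linked-vertices : ∀ {u v} (p : Walk R u v) → Linked R (vertices p)
    Linked-vertices [ v ]ʷ                    = [-]
    Linked-vertices (u ∷⟨ e ⟩ [ v ]ʷ)         = e ∷ [-]
    Linked-vertices (u ∷⟨ e ⟩ p@(_ ∷⟨ _ ⟩ _)) = e ∷ Linked-vertices p

    record Split {u v} (p : Walk R u v) : Set where
      field
        {end₁ start₂}  : V
        before         : Walk R u end₁
        edge           : R end₁ start₂
        after          : Walk R start₂ v
        vertices-split : vertices p ≡ vertices before ++ vertices after

    splitAtStart : ∀ {u v} (p : Walk R u v) → u ≢ v → Split p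
    splitAtStart [ v ]ʷ        u≢v = ⊥-elim (u≢v refl)
    splitAtStart (u ∷⟨ e ⟩ p) _   =
      record { before = [ u ]ʷ ; edge = e ; after = p ; vertices-split = refl }

    splitAtChange : ∀ {B : Set} → DecidableEquality B → (κ : V → B) → ∀ {u v z} (p : Walk R u v) →
                    z ∈ vertices p → κ z ≢ κ u → Σ (Split p) λ s → κ (Split.end₁ s) ≢ κ (Split.start₂ s)
    splitAtChange _≟ᴮ_ κ [ v ]ʷ (here refl) κz≢κu = ⊥-elim (κz≢κu refl)
    splitAtChange _≟ᴮ_ κ (u ∷⟨ e ⟩ p) (here refl) κz≢κu = ⊥-elim (κz≢κu refl)
    splitAtChange _≟ᴮ_ κ (_∷⟨_⟩_ u {w} e p) (there z∈p) κz≢κu with κ u ≟ᴮ κ w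
    ... | no κu≢κw =
      record { before = [ u ]ʷ ; edge = e ; after = p ; vertices-split = refl } , κu≢κw
    ... | yes κu≡κw with splitAtChange _≟ᴮ_ κ p z∈p (λ eq → κz≢κu (trans eq (sym κu≡κw)))
    ...   | s , change =
      record { before = u ∷⟨ e ⟩ before ; edge = edge ; after = after
             ; vertices-split = cong (u ∷_) vertices-split } , change
      where open Split s

  walk-map : ∀ {R R′ : V → V → Set} → (∀ {a b} → R a b → R′ a b) → ∀ {u v} → Walk R u v → Walk R′ u v
  walk-map f [ v ]ʷ        = [ v ]ʷ
  walk-map f (u ∷⟨ e ⟩ p) = u ∷⟨ f e ⟩ walk-map f p

  vertices-walk-map : ∀ {R R′ : V → V → Set} (f : ∀ {a b} → R a b → R′ a b) {u v} (p : Walk R u v) →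
                      vertices (walk-map f p) ≡ vertices p
  vertices-walk-map f [ v ]ʷ        = refl
  vertices-walk-map f (u ∷⟨ e ⟩ p) = cong (u ∷_) (vertices-walk-map f p)

  record HamPath (R : V → V → Set) (P : V → Set) (u v : V) : Set where
    field
      walk   : Walk R u v
      unique : Unique (vertices walk)
      inside : All P (vertices walk)
      covers : ∀ w → P w → w ∈ vertices walk

  hamPath : ∀ {R P u v} (p : Walk R u v) {L} → vertices p ≡ L →
            Unique L → All P L → (∀ w → P w → w ∈ L) → HamPath R P u v
  hamPath p refl uL inL covL = record { walk = p ; unique = uL ; inside = inL ; covers = covL }

  module _ {R : V → V → Set} {P : V → Set} where

    HamPath-map : ∀ {R′ : V → V → Set} → (∀ {a b} → R a b → R′ a b) →
                  ∀ {u v} → HamPath R P u v → HamPath R′ P u v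
    HamPath-map f H = hamPath (walk-map f walk) (vertices-walk-map f walk) unique inside covers
      where open HamPath H

    HamPath-resp : ∀ {Q : V → Set} → P ≐ Q → ∀ {u v} → HamPath R P u v → HamPath R Q u v
    HamPath-resp (P⊆Q , Q⊆P) H = record
      { walk = walk ; unique = unique ; inside = All.map P⊆Q inside ; covers = λ w → covers w ∘ Q⊆P }
      where open HamPath H

    module _ {Q : V → Set} (P∩Q≡∅ : Empty (P ∩ Q)) where

      private
        disjoint : ∀ {xs ys} → All P xs → All Q ys → Disjoint xs ys
        disjoint Pxs Qys (m₁ , m₂) = P∩Q≡∅ _ (All.lookup Pxs m₁ , All.lookup Qys m₂)

      HamPath-join : ∀ {u y y′ v} → HamPath R P u y → R y y′ → HamPath R Q y′ v →
                     HamPath R (P ∪ Q) u v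
      HamPath-join H₁ e H₂ =
        hamPath (H₁.walk ⟨ e ⟩ʷ H₂.walk) (vertices-⟨⟩ʷ H₁.walk e H₂.walk)
          (Unique.++⁺ H₁.unique H₂.unique (disjoint H₁.inside H₂.inside))
          (++⁺ (All.map inj₁ H₁.inside) (All.map inj₂ H₂.inside))
          λ { w (inj₁ Pw) → ∈-++⁺ˡ (H₁.covers w Pw) ; w (inj₂ Qw) → ∈-++⁺ʳ _ (H₂.covers w Qw) }
        where
        module H₁ = HamPath H₁
        module H₂ = HamPath H₂

      HamPath-splice : ∀ {u v p′ q′} (H : HamPath R P u v) (s : Split (HamPath.walk H)) →
                       R (Split.end₁ s) p′ → HamPath R Q p′ q′ → R q′ (Split.start₂ s) →
                       HamPath R (P ∪ Q) u v
      HamPath-splice H s e₁ C e₂ =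
        hamPath (before ⟨ e₁ ⟩ʷ (C.walk ⟨ e₂ ⟩ʷ after))
          (trans (vertices-⟨⟩ʷ before e₁ _) (cong (B ++_) (vertices-⟨⟩ʷ C.walk e₂ after)))
          (Unique-resp-↭ (↭⇒↭ₛ (shifts Cs B))
            (Unique.++⁺ C.unique uBA λ (m₁ , m₂) → disjoint (++⁺ PB PA) C.inside (m₂ , m₁)))
          (++⁺ (All.map inj₁ PB) (++⁺ (All.map inj₂ C.inside) (All.map inj₁ PA)))
          λ { w (inj₁ Pw) → ∈-resp-↭ (↭-sym (shifts B Cs))
                               (∈-++⁺ʳ Cs (subst (w ∈_) vs (H.covers w Pw)))
            ; w (inj₂ Qw) → ∈-++⁺ʳ B (∈-++⁺ˡ (C.covers w Qw)) }
        where
        module H = HamPath H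
        module C = HamPath C
        open Split s
        B = vertices before
        A′ = vertices after
        Cs = vertices C.walk
        vs : vertices H.walk ≡ B ++ A′
        vs = vertices-split
        uBA : Unique (B ++ A′)
        uBA = subst Unique vs H.unique
        PB : All P B
        PB = ++⁻ˡ B (subst (All P) vs H.inside)
        PA : All P A′
        PA = ++⁻ʳ B (subst (All P) vs H.inside)

same-or-flipped : ∀ e e′ → e′ ≡ e ⊎ e′ ≡ not e
same-or-flipped true  true  = inj₁ refl
same-or-flipped true  false = inj₂ refl
same-or-flipped false true  = inj₂ refl
same-or-flipped false false = inj₁ refl

parity-dichotomy : ∀ p q → q ≡ p ⊎ q ≡ p ⁻¹
parity-dichotomy 0ℙ 0ℙ = inj₁ refl
parity-dichotomy 0ℙ 1ℙ = inj₂ refl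
parity-dichotomy 1ℙ 0ℙ = inj₂ refl
parity-dichotomy 1ℙ 1ℙ = inj₁ refl

module Laceability {A : Set} (_≟ᴬ_ : DecidableEquality A) (F : ℕ) (x₀ y₀ : A)
  (colour : List A → Parity)
  (colour-swapAtᴸ : ∀ t xs → Unique xs → suc t < length xs → colour (swapAtᴸ t xs) ≡ colour xs ⁻¹)
  where

  open Removal _≟ᴬ_

  -- A vertex of level m is a permutation free ++ fixed ++ ending e with free an arrangement of the
  -- m symbols of S; level m edges swap two adjacent entries of free or the two entries of the
  -- ending (swapAtᴸ t swaps the 0-based positions t and t + 1), so level m is BS_m × K_2.

  V : Set
  V = Vec A (suc (suc F))

  colourᵛ : V → Parity
  colourᵛ = colour ∘ toList

  ending : Bool → List A
  ending true  = x₀ ∷ y₀ ∷ []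
  ending false = y₀ ∷ x₀ ∷ []

  ∈-ending : ∀ {x} e → x ∈ ending e → x ≡ x₀ ⊎ x ≡ y₀
  ∈-ending true  (here refl)         = inj₁ refl
  ∈-ending true  (there (here refl)) = inj₂ refl
  ∈-ending false (here refl)         = inj₂ refl
  ∈-ending false (there (here refl)) = inj₁ refl

  x₀∈ending : ∀ e → x₀ ∈ ending e
  x₀∈ending true  = here refl
  x₀∈ending false = there (here refl)

  y₀∈ending : ∀ e → y₀ ∈ ending e
  y₀∈ending true  = there (here refl)
  y₀∈ending false = here refl

  swapAtᴸ-ending : ∀ xs e → swapAtᴸ (length xs) (xs ++ ending e) ≡ xs ++ ending (not e)
  swapAtᴸ-ending xs true  = swapAtᴸ-++ xs x₀ y₀ []
  swapAtᴸ-ending xs false = swapAtᴸ-++ xs y₀ x₀ []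

  flip-ending : ∀ xs ys e → length xs + length ys ≡ F →
                swapAtᴸ F (xs ++ ys ++ ending e) ≡ xs ++ ys ++ ending (not e)
  flip-ending xs ys e fits = begin
    swapAtᴸ F (xs ++ ys ++ ending e)
      ≡⟨ cong₂ swapAtᴸ (sym (trans (length-++ xs) fits)) (sym (++-assoc xs ys (ending e))) ⟩
    swapAtᴸ (length (xs ++ ys)) ((xs ++ ys) ++ ending e)
      ≡⟨ swapAtᴸ-ending (xs ++ ys) e ⟩
    (xs ++ ys) ++ ending (not e)
      ≡⟨ ++-assoc xs ys (ending (not e)) ⟩
    xs ++ ys ++ ending (not e) ∎
    where open ≡-Reasoning

  length-ending : ∀ e → length (ending e) ≡ 2
  length-ending true  = refl
  length-ending false = refl

  record Frame (m : ℕ) (S fixed : List A) : Set where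
    field
      unique-S     : Unique S
      length-S     : length S ≡ m
      fits         : m + length fixed ≡ F
      unique-fixed : ∀ e → Unique (fixed ++ ending e)
      disjoint     : ∀ e → Disjoint S (fixed ++ ending e)

  Arrangement : List A → List A → Set
  Arrangement S ys = Unique ys × ys ⊆ S × S ⊆ ys

  record Vertex (m : ℕ) (S fixed : List A) (w : V) : Set where
    constructor vertex
    field
      free        : List A
      order       : Bool
      arranged    : Arrangement S free
      length-free : length free ≡ m
      layout      : toList w ≡ free ++ fixed ++ ending order

  Edge : ℕ → V → V → Set
  Edge m u v = ∃ λ t → (suc t < m ⊎ t ≡ F) × toList v ≡ swapAtᴸ t (toList u)

  Laceable : ℕ → Set
  Laceable m = ∀ {S fixed} → Frame m S fixed → ∀ {u v} → Vertex m S fixed u → Vertex m S fixed v →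
               colourᵛ u ≢ colourᵛ v → HamPath (Edge m) (Vertex m S fixed) u v

  Edge-mono : ∀ {m u v} → Edge m u v → Edge (suc m) u v
  Edge-mono (t , inj₁ t<m , eq) = t , inj₁ (m<n⇒m<1+n t<m) , eq
  Edge-mono (t , inj₂ t≡F , eq) = t , inj₂ t≡F , eq

  Edge-sym : ∀ {m u v} → Edge m u v → Edge m v u
  Edge-sym {u = u} {v} (t , ok , eq) =
    t , ok , trans (sym (swapAtᴸ-involutive t (toList u))) (cong (swapAtᴸ t) (sym eq))

  Vertex-unique : ∀ {m S fixed w} → Frame m S fixed → Vertex m S fixed w → Unique (toList w)
  Vertex-unique I (vertex ys e (uys , ys⊆S , _) _ eq) =
    subst Unique (sym eq)
      (Unique.++⁺ uys (Frame.unique-fixed I e) λ (m₁ , m₂) → Frame.disjoint I e (ys⊆S m₁ , m₂))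

  m≤F : ∀ {m S fixed} → Frame m S fixed → m ≤ F
  m≤F {m} {fixed = fixed} I = subst (m ≤_) (Frame.fits I) (m≤m+n m (length fixed))

  Edge-within : ∀ {m S fixed u v} → Frame m S fixed → Edge m u v →
                ∃ λ t → t ≤ F × toList v ≡ swapAtᴸ t (toList u)
  Edge-within I (t , inj₁ t<m , eq) = t , ≤-trans (≤-trans (n≤1+n t) (<⇒≤ t<m)) (m≤F I) , eq
  Edge-within I (t , inj₂ refl , eq) = t , ≤-refl , eq

  colour-Edge : ∀ {m S fixed u v} → Frame m S fixed → Vertex m S fixed u → Edge m u v →
                colourᵛ v ≡ colourᵛ u ⁻¹
  colour-Edge {u = u} I vu e with Edge-within I e
  ... | t , t≤F , eq = trans (cong colour eq)
    (colour-swapAtᴸ t (toList u) (Vertex-unique I vu)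
       (subst (suc t <_) (sym (length-toList u)) (s≤s (s≤s t≤F))))

  colour-Edge² : ∀ {m S fixed u w x} → Frame m S fixed → Vertex m S fixed u → Vertex m S fixed w →
                 Edge m u w → Edge m w x → colourᵛ x ≡ colourᵛ u
  colour-Edge² I vu vw e₁ e₂ =
    trans (colour-Edge I vw e₂) (trans (cong _⁻¹ (colour-Edge I vu e₁)) (⁻¹-involutive _))

  laceable-zero : Laceable 0
  laceable-zero {fixed = fixed} I {u} {v} vu@(vertex [] eᵤ _ _ equ) vv@(vertex [] eᵥ _ _ eqv) colour≢
    with same-or-flipped eᵤ eᵥ
  ... | inj₁ refl = ⊥-elim (colour≢ (cong colourᵛ (toList-injective′ (trans equ (sym eqv)))))
  ... | inj₂ refl = record
    { walk   = u ∷⟨ F , inj₂ refl , flip ⟩ [ v ]ʷ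
    ; unique = ((λ { refl → colour≢ refl }) ∷ []) ∷ [] ∷ []
    ; inside = vu ∷ vv ∷ []
    ; covers = covers }
    where
    flip : toList v ≡ swapAtᴸ F (toList u)
    flip = trans eqv (trans (sym (flip-ending [] fixed eᵤ (Frame.fits I))) (cong (swapAtᴸ F) (sym equ)))
    covers : ∀ w → Vertex 0 _ fixed w → w ∈ u ∷ v ∷ []
    covers w (vertex [] e _ _ eq) with same-or-flipped eᵤ e
    ... | inj₁ refl = here (toList-injective′ (trans eq (sym equ)))
    ... | inj₂ refl = there (here (toList-injective′ (trans eq (sym eqv))))

  Arrangement-∷ʳ⁻ : ∀ {S zs c} → Arrangement S (zs ∷ʳ c) → c ∈ S × Arrangement (remove c S) zs
  Arrangement-∷ʳ⁻ {S} {zs} {c} (u , sub , sup) with Unique-++⁻ zs u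
  ... | uzs , _ , apart =
    sub (∈-++⁺ʳ zs (here refl)) , uzs ,
    (λ m → ∈-remove⁺ (sub (∈-++⁺ˡ m)) λ { refl → apart (m , here refl) }) ,
    λ m → let x∈S , x≢c = ∈-remove⁻ S m in
      [ (λ m′ → m′) , (λ { (here x≡c) → ⊥-elim (x≢c x≡c) }) ]′ (∈-++⁻ zs (sup x∈S))

  Arrangement-∷ʳ⁺ : ∀ {S zs c} → c ∈ S → Arrangement (remove c S) zs → Arrangement S (zs ∷ʳ c)
  Arrangement-∷ʳ⁺ {S} {zs} {c} c∈S (u , sub , sup) =
    Unique.++⁺ u ([] ∷ []) (λ { (m , here refl) → proj₂ (∈-remove⁻ S (sub m)) refl }) ,
    (λ m → [ proj₁ ∘ ∈-remove⁻ S ∘ sub , (λ { (here refl) → c∈S }) ]′ (∈-++⁻ zs m)) ,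
    λ {x} x∈S → case x ≟ᴬ c of λ
      { (yes refl) → ∈-++⁺ʳ zs (here refl)
      ; (no x≢c)   → ∈-++⁺ˡ (sup (∈-remove⁺ x∈S x≢c)) }

  -- The vertices of level k + 1 whose last free entry is d.
  Block : List A → List A → ℕ → A → V → Set
  Block S fixed k d = Vertex k (remove d S) (d ∷ fixed)

  InBlocks : List A → List A → ℕ → List A → V → Set
  InBlocks S fixed k cs w = Any (λ d → Block S fixed k d w) cs

  frame-block : ∀ {k S fixed d} → Frame (suc k) S fixed → d ∈ S → Frame k (remove d S) (d ∷ fixed)
  frame-block {k} {S} {fixed} I d∈S = record
    { unique-S     = remove-unique unique-S
    ; length-S     = suc-injective (trans (length-remove unique-S d∈S) length-S)
    ; fits         = trans (+-suc k (length fixed)) fits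
    ; unique-fixed = λ e → ¬Any⇒All¬ _ (λ m → disjoint e (d∈S , m)) ∷ unique-fixed e
    ; disjoint     = λ e → λ { (m , here refl) → proj₂ (∈-remove⁻ S m) refl
                             ; (m , there m′) → disjoint e (proj₁ (∈-remove⁻ S m) , m′) } }
    where open Frame I

  block⇒vertex : ∀ {k S fixed d w} → d ∈ S → Block S fixed k d w → Vertex (suc k) S fixed w
  block⇒vertex {fixed = fixed} {d} d∈S (vertex zs e arr len eq) =
    vertex (zs ∷ʳ d) e (Arrangement-∷ʳ⁺ d∈S arr) (trans (length-∷ʳ zs) (cong suc len))
      (trans eq (sym (++-assoc zs [ d ] (fixed ++ ending e))))

  vertex⇒block : ∀ {k S fixed w} → Vertex (suc k) S fixed w → ∃ λ d → d ∈ S × Block S fixed k d w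
  vertex⇒block (vertex ys e arr len eq) with initLast ys
  vertex⇒block (vertex .[] e arr () eq) | []
  vertex⇒block {fixed = fixed} (vertex .(zs ∷ʳ d) e arr len eq) | zs ∷ʳ′ d =
    d , proj₁ (Arrangement-∷ʳ⁻ arr) ,
    vertex zs e (proj₂ (Arrangement-∷ʳ⁻ arr)) (suc-injective (trans (sym (length-∷ʳ zs)) len))
      (trans eq (++-assoc zs [ d ] (fixed ++ ending e)))

  entryAt-block : ∀ {k S fixed d w} → Vertex k S (d ∷ fixed) w → entryAt k (toList w) ≡ just d
  entryAt-block {fixed = fixed} {d} (vertex zs e _ refl eq) =
    trans (cong (entryAt (length zs)) eq) (entryAt-++ zs d (fixed ++ ending e))

  length-layout : ∀ {m S fixed} → Frame m S fixed → ∀ e → length (S ++ fixed ++ ending e) ≡ suc (suc F)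
  length-layout {m} {S} {fixed} I e = begin
    length (S ++ fixed ++ ending e)            ≡⟨ length-++ S ⟩
    length S + length (fixed ++ ending e)      ≡⟨ cong₂ _+_ length-S (length-++ fixed) ⟩
    m + (length fixed + length (ending e))     ≡⟨ sym (+-assoc m (length fixed) _) ⟩
    (m + length fixed) + length (ending e)     ≡⟨ cong₂ _+_ fits (length-ending e) ⟩
    F + 2                                      ≡⟨ +-comm F 2 ⟩
    suc (suc F)                                ∎
    where
    open ≡-Reasoning
    open Frame I

  arrange : ∀ {m S fixed} → Frame m S fixed → Bool → V
  arrange {S = S} {fixed} I e = cast (length-layout I e) (fromList (S ++ fixed ++ ending e))

  toList-arrange : ∀ {m S fixed} (I : Frame m S fixed) e → toList (arrange I e) ≡ S ++ fixed ++ ending e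
  toList-arrange {S = S} {fixed} I e =
    trans (toList-cast (length-layout I e) (fromList (S ++ fixed ++ ending e))) (toList∘fromList _)

  arrange-vertex : ∀ {m S fixed} (I : Frame m S fixed) e → Vertex m S fixed (arrange I e)
  arrange-vertex I e =
    vertex _ e (Frame.unique-S I , (λ m → m) , (λ m → m)) (Frame.length-S I) (toList-arrange I e)

  arrange-colour : ∀ {m S fixed} (I : Frame m S fixed) p → ∃ λ e → colourᵛ (arrange I e) ≡ p
  arrange-colour {S = S} {fixed} I p with parity-dichotomy (colourᵛ (arrange I true)) p
  ... | inj₁ p≡c = true , sym p≡c
  ... | inj₂ p≡c⁻¹ = false , trans (colour-Edge I (arrange-vertex I true) flip) (sym p≡c⁻¹)
    where
    open Frame I
    flip : Edge _ (arrange I true) (arrange I false)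
    flip = F , inj₂ refl ,
      trans (toList-arrange I false)
        (trans (sym (flip-ending S fixed true (trans (cong (_+ length fixed) length-S) fits)))
               (cong (swapAtᴸ F) (sym (toList-arrange I true))))

  Arrangement-resp : ∀ {S S′ ys} → S ⊆ S′ → S′ ⊆ S → Arrangement S ys → Arrangement S′ ys
  Arrangement-resp S⊆S′ S′⊆S (u , sub , sup) = u , S⊆S′ ∘ sub , sup ∘ S′⊆S

  remove-comm : ∀ {c d} S → remove c (remove d S) ⊆ remove d (remove c S)
  remove-comm S m =
    let m′ , x≢c = ∈-remove⁻ _ m ; x∈S , x≢d = ∈-remove⁻ S m′ in
    ∈-remove⁺ (∈-remove⁺ x∈S x≢c) x≢d

  swap-block : ∀ {k S fixed c d w} → c ∈ S → d ∈ remove c S →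
               Vertex k (remove d (remove c S)) (d ∷ c ∷ fixed) w →
               Block S fixed (suc k) d (swapAt k w) × Edge (suc (suc k)) w (swapAt k w)
  swap-block {S = S} {fixed} {c} {d} {w} c∈S d∈S-c (vertex zs e arr refl eq) =
    block⇒vertex c∈S-d
      (vertex zs e (Arrangement-resp (remove-comm S) (remove-comm S) arr) refl swapped) ,
    length zs , inj₁ ≤-refl , toList-swapAt (length zs) w
    where
    c∈S-d : c ∈ remove d S
    c∈S-d = ∈-remove⁺ c∈S (≢-sym (proj₂ (∈-remove⁻ S d∈S-c)))
    swapped : toList (swapAt (length zs) w) ≡ zs ++ c ∷ d ∷ fixed ++ ending e
    swapped = trans (toList-swapAt (length zs) w)
                (trans (cong (swapAtᴸ (length zs)) eq) (swapAtᴸ-++ zs d c (fixed ++ ending e)))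

  crossing : ∀ {k S fixed c d} → Frame (suc (suc k)) S fixed → c ∈ S → d ∈ S → c ≢ d → ∀ p →
             ∃ λ y → Block S fixed (suc k) c y × Block S fixed (suc k) d (swapAt k y) ×
                     Edge (suc (suc k)) y (swapAt k y) × colourᵛ y ≡ p
  crossing {S = S} I c∈S d∈S c≢d p =
    arrange I₂ e , block⇒vertex d∈S-c (arrange-vertex I₂ e) ,
    proj₁ swapped , proj₂ swapped , colour≡p
    where
    d∈S-c = ∈-remove⁺ d∈S (≢-sym c≢d)
    I₂ = frame-block (frame-block I c∈S) d∈S-c
    e = proj₁ (arrange-colour I₂ p)
    colour≡p = proj₂ (arrange-colour I₂ p)
    swapped = swap-block c∈S d∈S-c (arrange-vertex I₂ e)

  blocks-apart : ∀ {k S fixed c cs} → c ∉ cs → Empty (Block S fixed k c ∩ InBlocks S fixed k cs)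
  blocks-apart c∉cs w (bc , in-cs) with find in-cs
  ... | d , d∈cs , bd =
    c∉cs (subst (_∈ _) (just-injective (trans (sym (entryAt-block bd)) (entryAt-block bc))) d∈cs)

  InBlocks-∷ : ∀ {k S fixed c cs} →
               Block S fixed k c ∪ InBlocks S fixed k cs ≐ InBlocks S fixed k (c ∷ cs)
  InBlocks-∷ = [ here , there ]′ , λ { (here b) → inj₁ b ; (there b) → inj₂ b }

  Vertex≐InBlocks : ∀ {k S fixed cs} → All (_∈ S) cs → S ⊆ cs →
                    Vertex (suc k) S fixed ≐ InBlocks S fixed k cs
  Vertex≐InBlocks cs⊆S S⊆cs =
    (λ v → let d , d∈S , b = vertex⇒block v in lose (S⊆cs d∈S) b) ,
    (λ a → let d , d∈cs , b = find a in block⇒vertex (All.lookup cs⊆S d∈cs) b)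

  chain : ∀ {k S fixed} → Laceable k → Frame (suc k) S fixed →
          ∀ c ds → All (_∈ S) (c ∷ ds) → Unique (c ∷ ds) →
          ∀ {u v} → Block S fixed k c u → Block S fixed k (lastOf c ds) v → colourᵛ u ≢ colourᵛ v →
          HamPath (Edge (suc k)) (InBlocks S fixed k (c ∷ ds)) u v
  chain lace I c [] (c∈S ∷ []) _ bu bv colour≢ =
    HamPath-resp (here , λ { (here b) → b ; (there ()) })
      (HamPath-map Edge-mono (lace (frame-block I c∈S) bu bv colour≢))
  chain {zero} lace I c (d ∷ ds) (c∈S ∷ d∈S ∷ _) ((c≢d ∷ _) ∷ _) _ _ _ =
    ⊥-elim (c≢d (length≡1⇒≡ (Frame.length-S I) c∈S d∈S))
  chain {suc k} {S} {fixed} lace I c (d ∷ ds) (c∈S ∷ ds⊆S) (c∉ds ∷ unique-ds) {u} {v} bu bv colour≢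
    with crossing I c∈S (All.head ds⊆S) (All.head c∉ds) (colourᵛ u ⁻¹)
  ... | y , by , by′ , edge , colour-y =
    HamPath-resp (InBlocks-∷ {S = S} {fixed})
      (HamPath-join (blocks-apart {S = S} {fixed} (All¬⇒¬Any c∉ds)) H₁ edge H₂)
    where
    colour-y′ : colourᵛ (swapAt k y) ≡ colourᵛ u
    colour-y′ = trans (colour-Edge I (block⇒vertex c∈S by) edge)
                      (trans (cong _⁻¹ colour-y) (⁻¹-involutive (colourᵛ u)))
    H₁ = HamPath-map Edge-mono (lace (frame-block I c∈S) bu by λ eq → p≢p⁻¹ _ (trans eq colour-y))
    H₂ = chain lace I d ds ds⊆S unique-ds by′ bv λ eq → colour≢ (trans (sym colour-y′) eq)

  via-enumeration : ∀ {k S fixed a c} → Laceable k → Frame (suc k) S fixed → Enumeration S a c →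
                    ∀ {u v} → Block S fixed k a u → Block S fixed k c v → colourᵛ u ≢ colourᵛ v →
                    HamPath (Edge (suc k)) (Vertex (suc k) S fixed) u v
  via-enumeration lace I (enumeration rest refl unique sound complete) bu bv colour≢ =
    HamPath-resp (≐-sym (Vertex≐InBlocks sound complete)) (chain lace I _ rest sound unique bu bv colour≢)

  detour : ∀ {k S fixed a u v} → Laceable (suc k) → Frame (suc (suc k)) S fixed → a ∈ S →
           (H : HamPath (Edge (suc (suc k))) (Block S fixed (suc k) a) u v) → (s : Split (HamPath.walk H)) →
           entryAt k (toList (Split.end₁ s)) ≢ entryAt k (toList (Split.start₂ s)) ⊎
           length (remove a S) ≡ 1 →
           HamPath (Edge (suc (suc k))) (Vertex (suc (suc k)) S fixed) u v
  detour {k} {S} {fixed} {a} lace I a∈S H s change with inner-block end₁∈ | inner-block start₂∈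
    where
    open HamPath H
    open Split s
    inner-block : ∀ {w} → w ∈ vertices before ++ vertices after →
                  ∃ λ d → d ∈ remove a S × Vertex k (remove d (remove a S)) (d ∷ a ∷ fixed) w
    inner-block m = vertex⇒block (All.lookup inside (subst (_ ∈_) (sym vertices-split) m))
    end₁∈ = ∈-++⁺ˡ (end∈vertices before)
    start₂∈ = ∈-++⁺ʳ (vertices before) (start∈vertices after)
  ... | d , d∈ , bp | d′ , d′∈ , bq =
    HamPath-resp (≐-trans (InBlocks-∷ {S = S} {fixed}) (≐-sym (Vertex≐InBlocks sound complete)))
      (HamPath-splice (blocks-apart {S = S} {fixed} (Unique.Unique[x∷xs]⇒x∉xs unique)) H s
         (proj₂ swap-p) C (Edge-sym (proj₂ swap-q)))
    where
    open Split s
    entries≢⇒≢ : entryAt k (toList end₁) ≢ entryAt k (toList start₂) → d ≢ d′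
    entries≢⇒≢ entries≢ d≡d′ =
      entries≢ (trans (entryAt-block bp) (trans (cong just d≡d′) (sym (entryAt-block bq))))
    E = enumerate (remove-unique (Frame.unique-S I)) d∈ d′∈ (map₁ entries≢⇒≢ change)
    open Enumeration (Enumeration-∷ a∈S E)
    swap-p = swap-block a∈S d∈ bp
    swap-q = swap-block a∈S d′∈ bq
    vp = block⇒vertex a∈S (block⇒vertex d∈ bp)
    vq = block⇒vertex a∈S (block⇒vertex d′∈ bq)
    colour-p′ : colourᵛ (swapAt k end₁) ≡ colourᵛ end₁ ⁻¹
    colour-p′ = colour-Edge I vp (proj₂ swap-p)
    colour-q′ : colourᵛ (swapAt k start₂) ≡ colourᵛ end₁
    colour-q′ = colour-Edge² I vp vq edge (proj₂ swap-q)
    -- p′ and q′ are one and two edges away from end₁, so they have different colours.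
    C = chain lace I d (Enumeration.rest E) (All.tail sound) (AllPairs.tail unique) (proj₁ swap-p)
          (subst (λ x → Block S fixed (suc k) x (swapAt k start₂)) (sym ends) (proj₁ swap-q))
          λ eq → p≢p⁻¹ _ (sym (trans (sym colour-p′) (trans eq colour-q′)))

  split-at-entry-change : ∀ {k S fixed a u v R} → Frame (suc (suc (suc k))) S fixed → a ∈ S →
    (H : HamPath R (Block S fixed (suc (suc k)) a) u v) →
    Σ (Split (HamPath.walk H)) λ s →
      entryAt (suc k) (toList (Split.end₁ s)) ≢ entryAt (suc k) (toList (Split.start₂ s))
  split-at-entry-change {k} {a = a} {u} I a∈S H
    with vertex⇒block (All.lookup inside (start∈vertices walk))
    where
    open HamPath H
  ... | du , _ , bu with other-than (Frame.unique-S I-a) (Frame.length-S I-a) du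
    where
    I-a = frame-block I a∈S
  -- z is a vertex of block a whose entry at position suc k differs from that of u; as H visits z,
  -- that entry changes along some edge of H.
  ... | d , d∈ , d≢du =
    splitAtChange (≡-dec _≟ᴬ_) κ walk (covers _ (block⇒vertex d∈ z)) κz≢κu
    where
    open HamPath H
    I-a = frame-block I a∈S
    z = arrange-vertex (frame-block I-a d∈) true
    κ : V → Maybe A
    κ = entryAt (suc k) ∘ toList
    κz≢κu : κ (arrange (frame-block I-a d∈) true) ≢ κ u
    κz≢κu eq = d≢du (just-injective (trans (sym (entryAt-block z)) (trans eq (entryAt-block bu))))

  same-block : ∀ {k S fixed a} → Laceable k → Frame (suc k) S fixed → a ∈ S →
               ∀ {u v} → Block S fixed k a u → Block S fixed k a v → colourᵛ u ≢ colourᵛ v →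
               HamPath (Edge (suc k)) (Vertex (suc k) S fixed) u v
  same-block {zero} lace I a∈S bu bv colour≢ =
    via-enumeration lace I (enumerate (Frame.unique-S I) a∈S a∈S (inj₂ (Frame.length-S I)))
      bu bv colour≢
  same-block {suc zero} lace I a∈S bu bv colour≢ =
    detour lace I a∈S H (splitAtStart (HamPath.walk H) (colour≢ ∘ cong colourᵛ))
      (inj₂ (Frame.length-S (frame-block I a∈S)))
    where
    H = HamPath-map Edge-mono (lace (frame-block I a∈S) bu bv colour≢)
  same-block {suc (suc k)} lace I a∈S bu bv colour≢ =
    detour lace I a∈S H (proj₁ split) (inj₁ (proj₂ split))
    where
    H = HamPath-map Edge-mono (lace (frame-block I a∈S) bu bv colour≢)
    split = split-at-entry-change I a∈S H

  laceable : ∀ m → Laceable m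
  laceable zero    = laceable-zero
  laceable (suc m) I vu vv colour≢ with vertex⇒block vu | vertex⇒block vv
  ... | a , a∈S , bu | c , c∈S , bv with a ≟ᴬ c
  ...   | yes refl = same-block (laceable m) I a∈S bu bv colour≢
  ...   | no a≢c   =
    via-enumeration (laceable m) I (enumerate (Frame.unique-S I) a∈S c∈S (inj₁ a≢c)) bu bv colour≢

module EndingFixed (F : ℕ) (i j : Fin (suc (suc F))) (i≢j : i ≢ j) where

  open Removal (_≟_ {suc (suc F)})
  open Laceability _≟_ F i j sign sign-swapAtᴸ

  S : List (Fin (suc (suc F)))
  S = remove j (remove i (allFin _))

  ∈-S⁺ : ∀ {x} → x ≢ i → x ≢ j → x ∈ S
  ∈-S⁺ {x} x≢i x≢j = ∈-remove⁺ (∈-remove⁺ (∈-allFin x) x≢i) x≢j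

  ∈-S⁻ : ∀ {x} → x ∈ S → x ≢ i × x ≢ j
  ∈-S⁻ m = let m′ , x≢j = ∈-remove⁻ (remove i (allFin _)) m in
           proj₂ (∈-remove⁻ (allFin _) m′) , x≢j

  ∉-S-ending : ∀ {x} e → x ∈ S → x ∉ ending e
  ∉-S-ending e x∈S x∈e = [ proj₁ (∈-S⁻ x∈S) , proj₂ (∈-S⁻ x∈S) ]′ (∈-ending e x∈e)

  frame : Frame F S []
  frame = record
    { unique-S     = remove-unique {j} (remove-unique {i} (Unique.allFin⁺ _))
    ; length-S     = suc-injective (suc-injective (begin
        suc (suc (length S))
          ≡⟨ cong suc (length-remove {j} (remove-unique {i} (Unique.allFin⁺ _)) j∈) ⟩
        suc (length (remove i (allFin _)))  ≡⟨ length-remove {i} (Unique.allFin⁺ _) (∈-allFin i) ⟩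
        length (allFin (suc (suc F)))       ≡⟨ length-tabulate (λ x → x) ⟩
        suc (suc F)                         ∎))
    ; fits         = +-identityʳ F
    ; unique-fixed = λ { true → (i≢j ∷ []) ∷ [] ∷ [] ; false → (≢-sym i≢j ∷ []) ∷ [] ∷ [] }
    ; disjoint     = λ e (x∈S , x∈e) → ∉-S-ending e x∈S x∈e }
    where
    open ≡-Reasoning
    j∈ : j ∈ remove i (allFin _)
    j∈ = ∈-remove⁺ (∈-allFin j) (≢-sym i≢j)

  ending-vertex : ∀ {σ} → IsPerm σ → ∀ e ys → toList σ ≡ ys ++ ending e → Vertex F S [] σ
  ending-vertex {σ} perm e ys eq = vertex ys e (unique-ys , ys⊆S , S⊆ys) length-ys eq
    where
    unique-σ = subst Unique eq (Injective-lookup⇒Unique σ perm)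
    unique-ys = proj₁ (Unique-++⁻ ys unique-σ)
    apart = proj₂ (proj₂ (Unique-++⁻ ys unique-σ))
    ys⊆S : ys ⊆ S
    ys⊆S m = ∈-S⁺ (λ { refl → apart (m , x₀∈ending e) }) (λ { refl → apart (m , y₀∈ending e) })
    S⊆ys : S ⊆ ys
    S⊆ys {x} x∈S = [ (λ m → m) , (λ m → ⊥-elim (∉-S-ending e x∈S m)) ]′
                     (∈-++⁻ ys (subst (x ∈_) eq (IsPerm⇒∈ perm x)))
    length-ys : length ys ≡ F
    length-ys = +-cancelʳ-≡ 2 (length ys) F (begin
      length ys + 2                  ≡⟨ cong (length ys +_) (sym (length-ending e)) ⟩
      length ys + length (ending e)  ≡⟨ sym (length-++ ys) ⟩
      length (ys ++ ending e)        ≡⟨ cong length (sym eq) ⟩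
      length (toList σ)              ≡⟨ length-toList σ ⟩
      suc (suc F)                    ≡⟨ +-comm 2 F ⟩
      F + 2                          ∎)
      where open ≡-Reasoning

  PVertex⇒Vertex : ∀ {σ} → PVertex i j σ → Vertex F S [] σ
  PVertex⇒Vertex (perm , inj₁ (ys , eq)) = ending-vertex perm true ys eq
  PVertex⇒Vertex (perm , inj₂ (ys , eq)) = ending-vertex perm false ys eq

  Vertex⇒PVertex : ∀ {σ} → Vertex F S [] σ → PVertex i j σ
  Vertex⇒PVertex {σ} v@(vertex ys true  _ _ eq) =
    Unique⇒Injective-lookup σ (Vertex-unique frame v) , inj₁ (ys , eq)
  Vertex⇒PVertex {σ} v@(vertex ys false _ _ eq) =
    Unique⇒Injective-lookup σ (Vertex-unique frame v) , inj₂ (ys , eq)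

  Edge⇒PAdj : ∀ {u v} → Edge F u v → PAdj u v
  Edge⇒PAdj {u} (t , inj₁ t<F , eq) =
    suc t , inj₁ (s≤s z≤n , ∸-monoˡ-≤ 1 t<F) , toList-injective′ (trans eq (sym (toList-swapAt t u)))
  Edge⇒PAdj {u} (t , inj₂ refl , eq) =
    suc t , inj₂ refl , toList-injective′ (trans eq (sym (toList-swapAt t u)))

  hamiltonianPath : ∀ π τ → PVertex i j π → PVertex i j τ → parity π ≢ parity τ →
                    ∃ λ ps → HamPathP i j π τ ps
  hamiltonianPath π τ pπ pτ parity≢ = vertices walk , record
    { inP    = All.map Vertex⇒PVertex inside
    ; edges  = Linked.map Edge⇒PAdj (Linked-vertices walk)
    ; noRep  = unique
    ; covers = λ σ pσ → covers σ (PVertex⇒Vertex pσ)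
    ; start  = head-vertices walk
    ; finish = last-vertices walk }
    where
    open HamPath (laceable F frame (PVertex⇒Vertex pπ) (PVertex⇒Vertex pτ)
                   (parity≢ ∘ ℕ-parity⇒%2 (inversions (toList π)) (inversions (toList τ))))

proposition4 : (n : ℕ) → 5 ≤ n → (i j : Fin n) → i ≢ j →
    (π τ : Vec (Fin n) n) → PVertex i j π → PVertex i j τ →
    parity π ≢ parity τ →
    ∃ λ ps → HamPathP i j π τ ps
proposition4 (suc (suc F)) _ = EndingFixed.hamiltonianPath F
proposition4 (suc zero) (s≤s ())
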